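{- Let $k\ge3$, $n\ge1$ and $r\in\{1,\dots,k\}$. Then \[ \mathrm{mp}_{312}(n,k,r)=\begin{cases}1 & \text{if } r=1,\\ 2^{n/k-1} & \text{if } r=2 \text{ and } k\mid n,\\ 0&\text{otherwise.}\end{cases} \]
   Context: For integers $n\ge0$, $k\ge1$ and $r$, $\mathrm{MP}(n,k,r)$ is the set of permutations $\pi$ of $[n]$ with $\pi(i)\equiv r+i-1 \pmod k$ for all $1\le i\le n$. A permutation contains a pattern $\sigma$ if some subsequence of its one-line notation is order-isomorphic to $\sigma$, and avoids it otherwise. $\mathrm{mp}_\sigma(n,k,r)$ is the number of elements of $\mathrm{MP}(n,k,r)$ avoiding $\sigma$. -}

module Defs where

open import Data.Nat using (ℕ; zero; suc; _+_; _<_; NonZero)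
open import Data.Nat.DivMod using (_%_)
open import Data.Fin using (Fin; toℕ)
open import Data.Vec using (Vec; []; _∷_; lookup)
open import Data.List using (List; []; _∷_; concatMap; map; allFin; filter; length)
open import Data.Product using (Σ; _×_; ∃-syntax)
open import Relation.Binary.PropositionalEquality using (_≡_)
open import Relation.Nullary using (¬_)
open import Relation.Unary using (Decidable)
open import Relation.Nullary using (Dec; ¬?; _×-dec_; _→-dec_)
open import Data.Nat.Properties using (_≟_; _<?_)
import Data.Fin.Properties as FinP

-- A permutation of [n] in one-line notation: the vector (π(1),…,π(n)),
-- with value j ∈ [n] encoded as the Fin n element j-1, and
-- position i ∈ [n] encoded as the Fin n element i-1.
-- It is a permutation iff entries are pairwise distinct (injective).
IsPerm : ∀ {n} → Vec (Fin n) n → Set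
IsPerm {n} v = ∀ (i j : Fin n) → lookup v i ≡ lookup v j → i ≡ j

-- Membership in MP(n,k,r): π(i) ≡ r + i - 1 (mod k) for all 1 ≤ i ≤ n.
-- With 0-based position p = i-1 and value π(i) = toℕ (lookup v p) + 1:
--   π(i) ≡ r + p (mod k).
InMP : ∀ {n} (k r : ℕ) .{{_ : NonZero k}} → Vec (Fin n) n → Set
InMP {n} k r v =
  IsPerm v × (∀ (p : Fin n) → (toℕ (lookup v p) + 1) % k ≡ (r + toℕ p) % k)

Contains312 : ∀ {n} → Vec (Fin n) n → Set
Contains312 {n} v =
  ∃[ a ] ∃[ b ] ∃[ c ]
    (toℕ {n} a < toℕ b × toℕ b < toℕ c ×
     toℕ (lookup v b) < toℕ (lookup v c) ×
     toℕ (lookup v c) < toℕ (lookup v a))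

Avoids312 : ∀ {n} → Vec (Fin n) n → Set
Avoids312 v = ¬ Contains312 v

allVecs : (n m : ℕ) → List (Vec (Fin n) m)
allVecs n zero    = [] ∷ []
allVecs n (suc m) = concatMap (λ x → map (x ∷_) (allVecs n m)) (allFin n)

isPerm? : ∀ {n} (v : Vec (Fin n) n) → Dec (IsPerm v)
isPerm? v = FinP.all? λ i → FinP.all? λ j →
  FinP._≟_ (lookup v i) (lookup v j) →-dec FinP._≟_ i j

inMP? : ∀ {n} (k r : ℕ) .{{_ : NonZero k}} (v : Vec (Fin n) n) → Dec (InMP k r v)
inMP? k r v = isPerm? v ×-dec
  FinP.all? (λ p → (toℕ (lookup v p) + 1) % k ≟ (r + toℕ p) % k)

contains312? : ∀ {n} (v : Vec (Fin n) n) → Dec (Contains312 v)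
contains312? v = FinP.any? λ a → FinP.any? λ b → FinP.any? λ c →
  (toℕ a <? toℕ b) ×-dec ((toℕ b <? toℕ c) ×-dec
  ((toℕ (lookup v b) <? toℕ (lookup v c)) ×-dec
   (toℕ (lookup v c) <? toℕ (lookup v a))))

mp312 : (n k r : ℕ) .{{_ : NonZero k}} → ℕ
mp312 n k r = length (filter (λ v → inMP? k r v ×-dec ¬? (contains312? v)) (allVecs n n))

{-# OPTIONS --safe #-}
-- In a 312-avoiding permutation every entry left of the minimum is smaller than every
-- entry right of it, so π = α 1 β where α permutes the next |α| values and β the rest,
-- both again 312-avoiding. The condition π(i) ≡ r + i - 1 (mod k) passes to β unchanged
-- and to α with its offset shifted by one, and at the minimum it says |α| ≡ 1 - r.
-- Induction over this decomposition leaves three cases: for r = 1 every α is empty, so π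
-- is the identity; for r = 2 every α is ascending with k ∣ |α| + 1, so π is a
-- concatenation of blocks b+1, …, c-1, b with k ∣ b and k ∣ c, one for each of the
-- 2^(n/k - 1) compositions of n/k; for any other r no nonempty segment survives.
module Submission where

open import Defs
open import Data.Nat
  using (ℕ; zero; suc; pred; _+_; _*_; _^_; _∸_; _/_; _%_; _≤_; _<_; _<?_; z≤n; s≤s; s≤s⁻¹; z<s; NonZero; >-nonZero; >-nonZero⁻¹)
open import Data.Nat.DivMod
open import Data.Nat.Divisibility using (_∣_; _∣?_; _∣0; divides; divides-refl; m%n≡0⇒n∣m; n∣m⇒m%n≡0; ∣m∣n⇒∣m+n)
open import Data.Nat.Properties
open import Data.Fin using (Fin; toℕ; fromℕ<; punchOut)
open import Data.Fin.Properties using (toℕ-injective; toℕ<n; toℕ-fromℕ<; punchOut-injective; injective⇒≤)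
import Data.Fin.Properties as Fin
import Data.Fin as Fin
open import Data.Vec using (Vec; []; _∷_; lookup)
import Data.List.Relation.Unary.All as All
open import Data.List using (List; []; _∷_; map; concatMap; allFin; filter; length; _++_)
open import Data.List.Properties using (filter-≐; filter-none; filter-++; filter-accept; filter-reject; length-++; map-tabulate)
open import Data.Product using (_×_; _,_; proj₁; proj₂; ∃-syntax)
open import Data.Sum using (_⊎_; inj₁; inj₂; [_,_]′)
open import Data.Empty using (⊥; ⊥-elim)
open import Data.Unit using (⊤; tt)
open import Function using (id)
open import Relation.Binary.PropositionalEquality
open import Relation.Binary using (tri<; tri≈; tri>)
open import Induction.WellFounded using (Acc; acc)
open import Data.Nat.Induction using (<-wellFounded)
open import Algebra.Properties.CommutativeSemigroup +-commutativeSemigroup using (x∙yz≈y∙xz)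
open import Relation.Nullary using (¬_; ¬?; Dec; yes; no; _×-dec_; _⊎-dec_)
open import Relation.Unary using (Decidable; _≐_)

count : {A : Set} {P : A → Set} → Decidable P → List A → ℕ
count P? xs = length (filter P? xs)

module _ {A : Set} {P : A → Set} (P? : Decidable P) where

  count-none : (∀ x → ¬ P x) → ∀ xs → count P? xs ≡ 0
  count-none ¬P xs = cong length (filter-none P? {xs} (All.tabulate (λ {x} _ → ¬P x)))

  count-++ : ∀ xs ys → count P? (xs ++ ys) ≡ count P? xs + count P? ys
  count-++ xs ys = trans (cong length (filter-++ P? xs ys)) (length-++ (filter P? xs))

module _ {A B : Set} {P : B → Set} (P? : Decidable P) where

  count-map : (h : A → B) → ∀ xs → count P? (map h xs) ≡ count (λ x → P? (h x)) xs
  count-map h [] = refl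
  count-map h (x ∷ xs) with P? (h x)
  ... | yes _ = cong suc (count-map h xs)
  ... | no _ = count-map h xs

module _ {A : Set} {P Q : A → Set} (P? : Decidable P) (Q? : Decidable Q) where

  count-≐ : P ≐ Q → ∀ xs → count P? xs ≡ count Q? xs
  count-≐ P≐Q xs = cong length (filter-≐ P? Q? P≐Q xs)

  count-⊎ : {R : A → Set} (R? : Decidable R) → R ≐ (λ x → P x ⊎ Q x) → (∀ x → P x → ¬ Q x) →
    ∀ xs → count R? xs ≡ count P? xs + count Q? xs
  count-⊎ R? R≐P⊎Q disjoint [] = refl
  count-⊎ R? R≐P⊎Q disjoint (x ∷ xs) with R? x | P? x | Q? x
  ... | yes _ | yes p | yes q = ⊥-elim (disjoint x p q)
  ... | yes _ | yes _ | no _ = cong suc (count-⊎ R? R≐P⊎Q disjoint xs)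
  ... | yes _ | no _ | yes _ = trans (cong suc (count-⊎ R? R≐P⊎Q disjoint xs)) (sym (+-suc _ _))
  ... | yes r | no ¬p | no ¬q = ⊥-elim ([ ¬p , ¬q ]′ (proj₁ R≐P⊎Q r))
  ... | no ¬r | yes p | _ = ⊥-elim (¬r (proj₂ R≐P⊎Q (inj₁ p)))
  ... | no ¬r | no _ | yes q = ⊥-elim (¬r (proj₂ R≐P⊎Q (inj₂ q)))
  ... | no _ | no _ | no _ = count-⊎ R? R≐P⊎Q disjoint xs

occurrences : ∀ {N} → ℕ → List (Fin N) → ℕ
occurrences a = count (λ x → toℕ x ≟ a)

occurrences-map-suc : ∀ {N} a (xs : List (Fin N)) → occurrences (suc a) (map Fin.suc xs) ≡ occurrences a xs
occurrences-map-suc a xs = trans (count-map (λ x → toℕ x ≟ suc a) Fin.suc xs)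
  (count-≐ (λ x → suc (toℕ x) ≟ suc a) (λ x → toℕ x ≟ a) (suc-injective , cong suc) xs)

occurrences-map-suc-zero : ∀ {N} (xs : List (Fin N)) → occurrences 0 (map Fin.suc xs) ≡ 0
occurrences-map-suc-zero xs = trans (count-map (λ x → toℕ x ≟ 0) Fin.suc xs)
  (count-none (λ x → suc (toℕ x) ≟ 0) (λ _ ()) xs)

allFin-suc : ∀ N → allFin (suc N) ≡ Fin.zero ∷ map Fin.suc (allFin N)
allFin-suc N = cong (Fin.zero ∷_) (sym (map-tabulate id Fin.suc))

occurrences-allFin : ∀ {N a} → a < N → occurrences a (allFin N) ≡ 1
occurrences-allFin {suc N} {zero} _ =
  trans (cong (occurrences 0) (allFin-suc N)) (cong suc (occurrences-map-suc-zero (allFin N)))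
occurrences-allFin {suc N} {suc a} (s≤s a<N) = begin
  occurrences (suc a) (allFin (suc N))             ≡⟨ cong (occurrences (suc a)) (allFin-suc N) ⟩
  occurrences (suc a) (map Fin.suc (allFin N))     ≡⟨ occurrences-map-suc a (allFin N) ⟩
  occurrences a (allFin N)                         ≡⟨ occurrences-allFin a<N ⟩
  1                                                ∎
  where open ≡-Reasoning

module _ {N m : ℕ} {P : Vec (Fin N) (suc m) → Set} {Q : Vec (Fin N) m → Set}
         (P? : Decidable P) (Q? : Decidable Q) (a : ℕ)
         (P⇒ : ∀ {x w} → P (x ∷ w) → toℕ x ≡ a × Q w)
         (⇒P : ∀ {x w} → toℕ x ≡ a × Q w → P (x ∷ w)) where

  count-prepend : ∀ xs (W : List (Vec (Fin N) m)) →
    count P? (concatMap (λ x → map (x ∷_) W) xs) ≡ occurrences a xs * count Q? W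
  count-prepend [] W = refl
  count-prepend (x ∷ xs) W = begin
    count P? (map (x ∷_) W ++ concatMap (λ x → map (x ∷_) W) xs)
      ≡⟨ count-++ P? (map (x ∷_) W) _ ⟩
    count P? (map (x ∷_) W) + count P? (concatMap (λ x → map (x ∷_) W) xs)
      ≡⟨ cong₂ _+_ (count-map P? (x ∷_) W) (count-prepend xs W) ⟩
    count (λ w → P? (x ∷ w)) W + occurrences a xs * count Q? W
      ≡⟨ head-term (toℕ x ≟ a) ⟩
    occurrences a (x ∷ xs) * count Q? W
      ∎
    where
    open ≡-Reasoning
    head-term : Dec (toℕ x ≡ a) →
      count (λ w → P? (x ∷ w)) W + occurrences a xs * count Q? W ≡ occurrences a (x ∷ xs) * count Q? W
    head-term (yes x≡a) = trans
      (cong (_+ occurrences a xs * count Q? W)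
        (count-≐ (λ w → P? (x ∷ w)) Q? ((λ p → proj₂ (P⇒ p)) , (λ q → ⇒P (x≡a , q))) W))
      (cong (λ ys → length ys * count Q? W) (sym (filter-accept (λ y → toℕ y ≟ a) x≡a)))
    head-term (no x≢a) = trans
      (cong (_+ occurrences a xs * count Q? W)
        (count-none (λ w → P? (x ∷ w)) (λ w p → x≢a (proj₁ (P⇒ p))) W))
      (cong (λ ys → length ys * count Q? W) (sym (filter-reject (λ y → toℕ y ≟ a) x≢a)))

  count-allVecs-prepend : count P? (allVecs N (suc m)) ≡ occurrences a (allFin N) * count Q? (allVecs N m)
  count-allVecs-prepend = count-prepend (allFin N) (allVecs N m)

InjectiveBelow : ℕ → (ℕ → ℕ) → Set
InjectiveBelow n f = ∀ {i j} → i < n → j < n → f i ≡ f j → i ≡ j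

Avoids312Below : ℕ → (ℕ → ℕ) → Set
Avoids312Below n f = ∀ {a b c} → a < b → b < c → c < n → f b < f c → f c < f a → ⊥

bounded-injective⇒≤ : ∀ {A B} (g : Fin A → ℕ) → (∀ i → g i < B) → (∀ i j → g i ≡ g j → i ≡ j) → A ≤ B
bounded-injective⇒≤ g g<B inj = injective⇒≤ {f = λ i → fromℕ< (g<B i)} λ {i} {j} e →
  inj i j (trans (sym (toℕ-fromℕ< (g<B i))) (trans (cong toℕ e) (toℕ-fromℕ< (g<B j))))


bounded-injective⇒surjective : ∀ {L} (g : ℕ → ℕ) → (∀ {i} → i < L → g i < L) → InjectiveBelow L g →
  ∀ {w} → w < L → ∃[ i ] i < L × g i ≡ w
bounded-injective⇒surjective {suc L} g g<L inj {w} w<L with Fin.any? (λ (i : Fin (suc L)) → g (toℕ i) ≟ w)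
... | yes (i , gi≡w) = toℕ i , toℕ<n i , gi≡w
... | no missed = ⊥-elim (<-irrefl refl (bounded-injective⇒≤ (λ i → toℕ (skip i)) (λ i → toℕ<n (skip i)) skip-injective))
  where
  gFin : Fin (suc L) → Fin (suc L)
  gFin i = fromℕ< (g<L (toℕ<n i))
  toℕ-gFin : ∀ i → toℕ (gFin i) ≡ g (toℕ i)
  toℕ-gFin i = toℕ-fromℕ< (g<L (toℕ<n i))
  w≢gFin : ∀ i → fromℕ< w<L ≢ gFin i
  w≢gFin i e = missed (i , trans (sym (toℕ-gFin i)) (trans (cong toℕ (sym e)) (toℕ-fromℕ< w<L)))
  skip : Fin (suc L) → Fin L
  skip i = punchOut (w≢gFin i)
  skip-injective : ∀ i j → toℕ (skip i) ≡ toℕ (skip j) → i ≡ j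
  skip-injective i j e = toℕ-injective (inj (toℕ<n i) (toℕ<n j)
    (trans (sym (toℕ-gFin i)) (trans (cong toℕ (punchOut-injective (w≢gFin i) (w≢gFin j) (toℕ-injective e))) (toℕ-gFin j))))

module Congruence (k : ℕ) .{{_ : NonZero k}} where

  infix 4 _≋_
  _≋_ : ℕ → ℕ → Set
  a ≋ b = a % k ≡ b % k

  ≋-+ : ∀ {a b c d} → a ≋ b → c ≋ d → a + c ≋ b + d
  ≋-+ {a} {b} {c} {d} a≋b c≋d = begin
    (a + c) % k             ≡⟨ %-distribˡ-+ a c k ⟩
    (a % k + c % k) % k     ≡⟨ cong₂ (λ x y → (x + y) % k) a≋b c≋d ⟩
    (b % k + d % k) % k     ≡⟨ %-distribˡ-+ b d k ⟨
    (b + d) % k             ∎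
    where open ≡-Reasoning

  ≋-suc : ∀ {a b} → a ≋ b → suc a ≋ suc b
  ≋-suc = ≋-+ {1} {1} refl

  ≋-suc-injective : ∀ {a b} → suc a ≋ suc b → a ≋ b
  ≋-suc-injective {a} {b} e = begin
    a % k                   ≡⟨ [m+n]%n≡m%n a k ⟨
    (a + k) % k             ≡⟨ cong (_% k) (shift a) ⟩
    (suc a + pred k) % k    ≡⟨ ≋-+ e refl ⟩
    (suc b + pred k) % k    ≡⟨ cong (_% k) (shift b) ⟨
    (b + k) % k             ≡⟨ [m+n]%n≡m%n b k ⟩
    b % k                   ∎
    where
    open ≡-Reasoning
    shift : ∀ x → x + k ≡ suc x + pred k
    shift x = trans (cong (x +_) (sym (suc-pred k))) (+-suc x (pred k))

  ≋-cancelˡ : ∀ t {a b} → t + a ≋ t + b → a ≋ b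
  ≋-cancelˡ zero e = e
  ≋-cancelˡ (suc t) e = ≋-cancelˡ t (≋-suc-injective e)

  ∣⇒≋0 : ∀ {a} → k ∣ a → a ≋ 0
  ∣⇒≋0 {a} k∣a = trans (n∣m⇒m%n≡0 a k k∣a) (sym (m<n⇒m%n≡m (>-nonZero⁻¹ k)))

  ≋0⇒∣ : ∀ {a} → a ≋ 0 → k ∣ a
  ≋0⇒∣ {a} a≋0 = m%n≡0⇒n∣m a k (trans a≋0 (m<n⇒m%n≡m (>-nonZero⁻¹ k)))

  ≋⇒≡ : ∀ {a b} → a < k → b < k → a ≋ b → a ≡ b
  ≋⇒≡ a<k b<k a≋b = trans (sym (m<n⇒m%n≡m a<k)) (trans a≋b (m<n⇒m%n≡m b<k))

  shift-≉ : ∀ d {a} → 0 < d → d < k → ¬ (d + a ≋ a)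
  shift-≉ d {a} 0<d d<k d+a≋a = <⇒≢ 0<d (sym (≋⇒≡ d<k (<-trans 0<d d<k) d≋0))
    where
    d≋0 : d ≋ 0
    d≋0 = ≋-cancelˡ a (begin
      (a + d) % k    ≡⟨ cong (_% k) (+-comm a d) ⟩
      (d + a) % k    ≡⟨ d+a≋a ⟩
      a % k          ≡⟨ cong (_% k) (+-identityʳ a) ⟨
      (a + 0) % k    ∎)
      where open ≡-Reasoning

  ≋⇒≡-positive : ∀ {a b} → 0 < a → a < k → b ≤ k → a ≋ b → a ≡ b
  ≋⇒≡-positive {a} {b} 0<a a<k b≤k a≋b with m≤n⇒m<n∨m≡n b≤k
  ... | inj₁ b<k = ≋⇒≡ a<k b<k a≋b
  ... | inj₂ refl = ⊥-elim (<⇒≢ 0<a (sym (trans (sym (m<n⇒m%n≡m a<k)) (trans a≋b (n%n≡0 k)))))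

-- The two shapes of valid permutations

Consecutive : (ℕ → ℕ) → ℕ → ℕ → Set
Consecutive g p zero = ⊤
Consecutive g p (suc m) = g 0 ≡ p × Consecutive (λ i → g (suc i)) (suc p) m

consecutive? : ∀ g p m → Dec (Consecutive g p m)
consecutive? g p zero = yes tt
consecutive? g p (suc m) = g 0 ≟ p ×-dec consecutive? (λ i → g (suc i)) (suc p) m

Consecutive⇒≡ : ∀ g p m → Consecutive g p m → ∀ {i} → i < m → g i ≡ p + i
Consecutive⇒≡ g p (suc m) (g0 , _) {zero} _ = trans g0 (sym (+-identityʳ p))
Consecutive⇒≡ g p (suc m) (_ , rest) {suc i} (s≤s i<m) =
  trans (Consecutive⇒≡ (λ i → g (suc i)) (suc p) m rest i<m) (sym (+-suc p i))

≡⇒Consecutive : ∀ g p m → (∀ {i} → i < m → g i ≡ p + i) → Consecutive g p m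
≡⇒Consecutive g p zero _ = tt
≡⇒Consecutive g p (suc m) g≡ = trans (g≡ z<s) (+-identityʳ p) ,
  ≡⇒Consecutive (λ i → g (suc i)) (suc p) m (λ {i} i<m → trans (g≡ (s≤s i<m)) (+-suc p i))

module BlockStructure (k : ℕ) where

  -- Blocks g s p m: the values g 0, …, g (m-1) continue a concatenation of blocks
  -- b+1, …, c-1, b closed at multiples c of k, where p is the last value placed (or the
  -- start value) and s is the minimum b of the open block, due when it is closed.
  Blocks : (ℕ → ℕ) → ℕ → ℕ → ℕ → Set
  Blocks g s p zero = s ≡ p
  Blocks g s p (suc m) = (g 0 ≡ suc p × Blocks (λ i → g (suc i)) s (suc p) m)
                       ⊎ (k ∣ suc p × g 0 ≡ s × Blocks (λ i → g (suc i)) (suc p) (suc p) m)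

  blocks? : ∀ g s p m → Dec (Blocks g s p m)
  blocks? g s p zero = s ≟ p
  blocks? g s p (suc m) = (g 0 ≟ suc p ×-dec blocks? (λ i → g (suc i)) s (suc p) m)
                        ⊎-dec (k ∣? suc p ×-dec (g 0 ≟ s ×-dec blocks? (λ i → g (suc i)) (suc p) (suc p) m))

  Blocks-cong : ∀ {g h} → (∀ i → g i ≡ h i) → ∀ {s p} m → Blocks g s p m → Blocks h s p m
  Blocks-cong g≗h zero b = b
  Blocks-cong g≗h (suc m) (inj₁ (g0 , b)) = inj₁ (trans (sym (g≗h 0)) g0 , Blocks-cong (λ i → g≗h (suc i)) m b)
  Blocks-cong g≗h (suc m) (inj₂ (k∣ , g0 , b)) = inj₂ (k∣ , trans (sym (g≗h 0)) g0 , Blocks-cong (λ i → g≗h (suc i)) m b)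

  Blocks-cons-block : ∀ t g s p L → (∀ {x} → x < t → g x ≡ suc (p + x)) → g t ≡ s → k ∣ suc (p + t) →
    Blocks (λ i → g (suc t + i)) (suc (p + t)) (suc (p + t)) L → Blocks g s p (suc t + L)
  Blocks-cons-block zero g s p L ascending gt≡s k∣ rest rewrite +-identityʳ p =
    inj₂ (k∣ , gt≡s , rest)
  Blocks-cons-block (suc t) g s p L ascending gt≡s k∣ rest rewrite +-suc p t =
    inj₁ (trans (ascending (s≤s z≤n)) (cong suc (+-identityʳ p)) ,
          Blocks-cons-block t (λ i → g (suc i)) s (suc p) L
            (λ x<t → trans (ascending (s≤s x<t)) (cong suc (+-suc p _))) gt≡s k∣ rest)

  Blocks-values : ∀ g {s p m} → Blocks g s p m → s ≤ p → ∀ {i} → i < m → g i ≡ s ⊎ p < g i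
  Blocks-values g {m = suc m} (inj₁ (g0 , b)) s≤p {zero} _ = inj₂ (≤-reflexive (sym g0))
  Blocks-values g {m = suc m} (inj₁ (g0 , b)) s≤p {suc i} (s≤s i<m)
    with Blocks-values (λ i → g (suc i)) b (m≤n⇒m≤1+n s≤p) i<m
  ... | inj₁ gi≡s = inj₁ gi≡s
  ... | inj₂ p<gi = inj₂ (<-trans (n<1+n _) p<gi)
  Blocks-values g {m = suc m} (inj₂ (_ , g0 , b)) s≤p {zero} _ = inj₁ g0
  Blocks-values g {m = suc m} (inj₂ (_ , g0 , b)) s≤p {suc i} (s≤s i<m)
    with Blocks-values (λ i → g (suc i)) b ≤-refl i<m
  ... | inj₁ gi≡p = inj₂ (≤-reflexive (sym gi≡p))
  ... | inj₂ p<gi = inj₂ (<-trans (n<1+n _) p<gi)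

  Blocks-head-fresh : ∀ g {s p m} → Blocks g s p (suc m) → s ≤ p → ∀ {j} → j < m → g 0 ≢ g (suc j)
  Blocks-head-fresh g (inj₁ (g0 , b)) s≤p j<m e with Blocks-values (λ i → g (suc i)) b (m≤n⇒m≤1+n s≤p) j<m
  ... | inj₁ gj≡s = <⇒≱ (s≤s s≤p) (≤-reflexive (trans (sym g0) (trans e gj≡s)))
  ... | inj₂ p<gj = <-irrefl (trans (sym g0) e) p<gj
  Blocks-head-fresh g (inj₂ (_ , g0 , b)) s≤p j<m e with Blocks-values (λ i → g (suc i)) b ≤-refl j<m
  ... | inj₁ gj≡p = <⇒≱ (s≤s s≤p) (≤-reflexive (trans (sym gj≡p) (trans (sym e) g0)))
  ... | inj₂ p<gj = <⇒≱ (<-trans (s≤s s≤p) p<gj) (≤-reflexive (trans (sym e) g0))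

  Blocks-tail : ∀ g {s p m} → Blocks g s p (suc m) → s ≤ p →
    ∃[ s′ ] s′ ≤ suc p × Blocks (λ i → g (suc i)) s′ (suc p) m
  Blocks-tail g (inj₁ (_ , b)) s≤p = _ , m≤n⇒m≤1+n s≤p , b
  Blocks-tail g (inj₂ (_ , _ , b)) s≤p = _ , ≤-refl , b

  Blocks-injective : ∀ g {s p m} → Blocks g s p m → s ≤ p → InjectiveBelow m g
  Blocks-injective g {m = suc m} b s≤p {zero} {zero} _ _ _ = refl
  Blocks-injective g {m = suc m} b s≤p {zero} {suc j} _ (s≤s j<m) e = ⊥-elim (Blocks-head-fresh g b s≤p j<m e)
  Blocks-injective g {m = suc m} b s≤p {suc i} {zero} (s≤s i<m) _ e = ⊥-elim (Blocks-head-fresh g b s≤p i<m (sym e))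
  Blocks-injective g {m = suc m} b s≤p {suc i} {suc j} (s≤s i<m) (s≤s j<m) e =
    let (_ , s′≤ , b′) = Blocks-tail g b s≤p in cong suc (Blocks-injective (λ i → g (suc i)) b′ s′≤ i<m j<m e)

  Blocks-avoids312 : ∀ g {s p m} → Blocks g s p m → s ≤ p → Avoids312Below m g
  Blocks-avoids312 g {m = suc m} b s≤p {suc a} {suc b′} {suc c} (s≤s a<b) (s≤s b<c) (s≤s c<m) =
    let (_ , s′≤ , tail) = Blocks-tail g b s≤p in Blocks-avoids312 (λ i → g (suc i)) tail s′≤ a<b b<c c<m
  Blocks-avoids312 g {m = suc m} (inj₁ (g0 , tail)) s≤p {zero} {suc b} {suc c} _ (s≤s b<c) (s≤s c<m) gb<gc gc<g0
    with Blocks-values (λ i → g (suc i)) tail (m≤n⇒m≤1+n s≤p) c<m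
  ... | inj₂ p<gc = <-asym p<gc (subst (g (suc c) <_) g0 gc<g0)
  ... | inj₁ gc≡s with Blocks-values (λ i → g (suc i)) tail (m≤n⇒m≤1+n s≤p) (<-trans b<c c<m)
  ...   | inj₁ gb≡s = <-irrefl (trans gb≡s (sym gc≡s)) gb<gc
  ...   | inj₂ p<gb = <-asym (subst (_< g (suc b)) (sym gc≡s) (≤-trans (s≤s s≤p) (<⇒≤ p<gb))) gb<gc
  Blocks-avoids312 g {s} {m = suc m} (inj₂ (_ , g0 , tail)) s≤p {zero} {suc b} {suc c} _ (s≤s b<c) (s≤s c<m) gb<gc gc<g0
    with Blocks-values (λ i → g (suc i)) tail ≤-refl c<m
  ... | inj₁ gc≡p = <⇒≱ (subst (_< s) gc≡p (subst (g (suc c) <_) g0 gc<g0)) (m≤n⇒m≤1+n s≤p)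
  ... | inj₂ p<gc = <⇒≱ (subst (g (suc c) <_) g0 gc<g0) (≤-trans (m≤n⇒m≤1+n s≤p) (<⇒≤ p<gc))

  module _ .{{_ : NonZero k}} where
    open Congruence k

    Blocks-residues : ∀ g {s p m} → Blocks g s p m → k ∣ s → ∀ {i} → i < m → g i + 1 ≋ 2 + (p + i)
    Blocks-residues g {p = p} {suc m} (inj₁ (g0 , tail)) k∣s {zero} _ =
      cong (_% k) (trans (cong (_+ 1) g0) (trans (+-comm (suc p) 1) (cong (2 +_) (sym (+-identityʳ p)))))
    Blocks-residues g {s} {p} {suc m} (inj₂ (k∣p+1 , g0 , tail)) k∣s {zero} _ = begin
      (g 0 + 1) % k     ≡⟨ cong (λ x → (x + 1) % k) g0 ⟩
      (s + 1) % k       ≡⟨ ≋-+ (trans (∣⇒≋0 k∣s) (sym (∣⇒≋0 k∣p+1))) refl ⟩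
      (suc p + 1) % k   ≡⟨ cong (_% k) (trans (+-comm (suc p) 1) (cong (2 +_) (sym (+-identityʳ p)))) ⟩
      (2 + (p + 0)) % k ∎
      where open ≡-Reasoning
    Blocks-residues g {p = p} {suc m} (inj₁ (_ , tail)) k∣s {suc i} (s≤s i<m) =
      trans (Blocks-residues (λ i → g (suc i)) tail k∣s i<m) (cong (λ x → (2 + x) % k) (sym (+-suc p i)))
    Blocks-residues g {p = p} {suc m} (inj₂ (k∣p+1 , _ , tail)) k∣s {suc i} (s≤s i<m) =
      trans (Blocks-residues (λ i → g (suc i)) tail k∣p+1 i<m) (cong (λ x → (2 + x) % k) (sym (+-suc p i)))

-- Decomposition at the minimum

module Segments (n : ℕ) (f : ℕ → ℕ) (f-injective : InjectiveBelow n f) (f-avoids312 : Avoids312Below n f) where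

  record Segment (P V L : ℕ) : Set where
    field
      fits : P + L ≤ n
      range : ∀ {i} → i < L → V ≤ f (P + i) × f (P + i) < V + L

  module _ {P V L} (seg : Segment P V L) where
    open Segment seg

    position< : ∀ {i} → i < L → P + i < n
    position< i<L = <-≤-trans (+-monoʳ-< P i<L) fits

    segment-injective : InjectiveBelow L (λ i → f (P + i))
    segment-injective {i} {j} i<L j<L e = +-cancelˡ-≡ P i j (f-injective (position< i<L) (position< j<L) e)

    segment-onto : ∀ {w} → w < L → ∃[ i ] i < L × f (P + i) ≡ V + w
    segment-onto {w} w<L =
      let (i , i<L , e) = bounded-injective⇒surjective offset offset< offset-injective w<L
      in i , i<L , trans (sym (V+offset i<L)) (cong (V +_) e)
      where
      offset : ℕ → ℕ
      offset i = f (P + i) ∸ V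
      V+offset : ∀ {i} → i < L → V + offset i ≡ f (P + i)
      V+offset i<L = m+[n∸m]≡n (proj₁ (range i<L))
      offset< : ∀ {i} → i < L → offset i < L
      offset< i<L = m<n+o⇒m∸n<o _ V {{>-nonZero (≤-<-trans z≤n w<L)}} (proj₂ (range i<L))
      offset-injective : InjectiveBelow L offset
      offset-injective i<L j<L e =
        segment-injective i<L j<L (trans (sym (V+offset i<L)) (trans (cong (V +_) e) (V+offset j<L)))

  module AtMinimum {P V L} (seg : Segment P V (suc L)) {j} (j<1+L : j < suc L) (f-at-minimum : f (P + j) ≡ V) where
    open Segment seg

    above-minimum : ∀ {i} → i < suc L → i ≢ j → V < f (P + i)
    above-minimum i<1+L i≢j = ≤∧≢⇒< (proj₁ (range i<1+L))
      (λ V≡f → i≢j (segment-injective seg i<1+L j<1+L (trans (sym V≡f) (sym f-at-minimum))))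

    -- Otherwise the minimum would be the 1 of a 312.
    left<right : ∀ {x y} → x < j → j < y → y < suc L → f (P + x) < f (P + y)
    left<right {x} {y} x<j j<y y<1+L with <-cmp (f (P + x)) (f (P + y))
    ... | tri< fx<fy _ _ = fx<fy
    ... | tri≈ _ fx≡fy _ =
      ⊥-elim (<-irrefl (segment-injective seg (<-trans x<j j<1+L) y<1+L fx≡fy) (<-trans x<j j<y))
    ... | tri> _ _ fy<fx = ⊥-elim (f-avoids312 (+-monoʳ-< P x<j) (+-monoʳ-< P j<y) (position< seg y<1+L)
      (subst (_< f (P + y)) (sym f-at-minimum) (above-minimum y<1+L (>⇒≢ j<y))) fy<fx)

    -- Otherwise the j + 1 values V+1, …, V+j+1 would all be taken left of the minimum.
    left-bounded : ∀ {x} → x < j → f (P + x) < V + suc j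
    left-bounded {x} x<j with f (P + x) <? V + suc j
    ... | yes fx< = fx<
    ... | no fx≮ = ⊥-elim (<-irrefl refl (bounded-injective⇒≤ preimage preimage<j preimage-injective))
      where
      large : V + suc j ≤ f (P + x)
      large = ≮⇒≥ fx≮
      1+j<1+L : suc j < suc L
      1+j<1+L = +-cancelˡ-< V (suc j) (suc L) (≤-<-trans large (proj₂ (range (<-trans x<j j<1+L))))
      in-range : ∀ (w : Fin (suc j)) → suc (toℕ w) < suc L
      in-range w = ≤-<-trans (s≤s (s≤s⁻¹ (toℕ<n w))) 1+j<1+L
      preimage : Fin (suc j) → ℕ
      preimage w = proj₁ (segment-onto seg (in-range w))
      preimage-value : ∀ w → f (P + preimage w) ≡ V + suc (toℕ w)
      preimage-value w = proj₂ (proj₂ (segment-onto seg (in-range w)))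
      preimage<j : ∀ w → preimage w < j
      preimage<j w with <-cmp (preimage w) j
      ... | tri< lt _ _ = lt
      ... | tri≈ _ e _ = ⊥-elim (m≢1+m+n V (trans (sym f-at-minimum)
              (trans (cong (λ i → f (P + i)) (sym e)) (trans (preimage-value w) (+-suc V (toℕ w))))))
      ... | tri> _ _ gt = ⊥-elim (<⇒≱ (left<right x<j gt (proj₁ (proj₂ (segment-onto seg (in-range w)))))
              (≤-trans (≤-reflexive (preimage-value w)) (≤-trans (+-monoʳ-≤ V (s≤s (s≤s⁻¹ (toℕ<n w)))) large)))
      preimage-injective : ∀ w w′ → preimage w ≡ preimage w′ → w ≡ w′
      preimage-injective w w′ e = toℕ-injective (suc-injective (+-cancelˡ-≡ V _ _
        (trans (sym (preimage-value w)) (trans (cong (λ i → f (P + i)) e) (preimage-value w′)))))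

    left-segment : Segment P (suc V) j
    left-segment = record
      { fits = ≤-trans (+-monoʳ-≤ P (<⇒≤ j<1+L)) fits
      ; range = λ {x} x<j → above-minimum (<-trans x<j j<1+L) (<⇒≢ x<j) ,
                            subst (f (P + x) <_) (+-suc V j) (left-bounded x<j)
      }

    rest : ℕ
    rest = L ∸ j

    lengths : suc j + rest ≡ suc L
    lengths = cong suc (m+[n∸m]≡n (s≤s⁻¹ j<1+L))

    right-position< : ∀ {y} → y < rest → suc j + y < suc L
    right-position< {y} y<rest = subst (suc j + y <_) lengths (+-monoʳ-< (suc j) y<rest)

    right-position : ∀ {i} → j < i → i < suc L → ∃[ y ] y < rest × suc j + y ≡ i
    right-position {i} j<i i<1+L = i ∸ suc j , +-cancelˡ-< (suc j) _ rest i∸ , m+[n∸m]≡n j<i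
      where
      i∸ : suc j + (i ∸ suc j) < suc j + rest
      i∸ = subst₂ _<_ (sym (m+[n∸m]≡n j<i)) (sym lengths) i<1+L

    right-segment : Segment (P + suc j) (V + suc j) rest
    right-segment = record
      { fits = subst (_≤ n) (sym (trans (+-assoc P (suc j) rest) (cong (P +_) lengths))) fits
      ; range = λ {y} y<rest → subst (λ i → V + suc j ≤ f i × f i < V + suc j + rest) (sym (+-assoc P (suc j) y))
                  (lower y<rest , subst (f (P + (suc j + y)) <_) (sym (trans (+-assoc V (suc j) rest) (cong (V +_) lengths)))
                                    (proj₂ (range (right-position< y<rest))))
      }
      where
      -- A small value right of the minimum is already taken by the left segment.
      lower : ∀ {y} → y < rest → V + suc j ≤ f (P + (suc j + y))
      lower {y} y<rest with f (P + (suc j + y)) <? V + suc j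
      ... | no fy≮ = ≮⇒≥ fy≮
      ... | yes fy< = ⊥-elim (<-irrefl x≡y (<-trans x<j j<y′))
        where
        j<y′ : j < suc j + y
        j<y′ = s≤s (m≤m+n j y)
        V<fy = above-minimum (right-position< y<rest) (>⇒≢ j<y′)
        w = f (P + (suc j + y)) ∸ suc V
        V+w : suc V + w ≡ f (P + (suc j + y))
        V+w = m+[n∸m]≡n V<fy
        w<j : w < j
        w<j = +-cancelˡ-< (suc V) w j (subst₂ _<_ (sym V+w) (+-suc V j) fy<)
        x = proj₁ (segment-onto left-segment w<j)
        x<j = proj₁ (proj₂ (segment-onto left-segment w<j))
        x≡y : x ≡ suc j + y
        x≡y = segment-injective seg (<-trans x<j j<1+L) (right-position< y<rest)
                (trans (proj₂ (proj₂ (segment-onto left-segment w<j))) V+w)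

  module Classification (k : ℕ) .{{_ : NonZero k}} (k≥3 : 3 ≤ k) (r : ℕ) where
    open Congruence k
    open BlockStructure k

    -- The MP congruence on a segment; e starts at 1 and grows by one on each passage to a left part.
    Residues : ℕ → ℕ → ℕ → ℕ → Set
    Residues P V L e = ∀ {i} → i < L → f (P + i) + e ≋ r + (V + i)

    Shape : ℕ → ℕ → ℕ → ℕ → Set
    Shape P V L e = (e ≋ r → ∀ {i} → i < L → f (P + i) ≡ V + i)
                  × (suc e ≋ r → k ∣ L × (k ∣ V → Blocks (λ i → f (P + i)) V V L))
                  × (¬ e ≋ r → ¬ suc e ≋ r → L ≡ 0)

    classify : ∀ {P V L e} → Acc _<_ L → Segment P V L → Residues P V L e → Shape P V L e
    classify {L = zero} _ _ _ = (λ _ ()) , (λ _ → (k ∣0) , (λ _ → refl)) , (λ _ _ → refl)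
    classify {P} {V} {suc L} {e} (acc smaller) seg residues with segment-onto seg z<s
    ... | j , j<1+L , fj≡V+0 = identity , blocks , empty
      where
      f-at-minimum : f (P + j) ≡ V
      f-at-minimum = trans fj≡V+0 (+-identityʳ V)
      open AtMinimum seg j<1+L f-at-minimum

      left-residues : Residues P (suc V) j (suc e)
      left-residues {x} x<j = begin
        (f (P + x) + suc e) % k     ≡⟨ cong (_% k) (+-suc (f (P + x)) e) ⟩
        suc (f (P + x) + e) % k     ≡⟨ ≋-suc (residues (<-trans x<j j<1+L)) ⟩
        suc (r + (V + x)) % k       ≡⟨ cong (_% k) (+-suc r (V + x)) ⟨
        (r + (suc V + x)) % k       ∎
        where open ≡-Reasoning

      right-residues : Residues (P + suc j) (V + suc j) rest e
      right-residues {y} y<rest = subst₂ (λ a b → f a + e ≋ r + b) (sym (+-assoc P (suc j) y)) (sym (+-assoc V (suc j) y))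
        (residues (right-position< y<rest))

      left = classify (smaller j<1+L) left-segment left-residues
      right = classify (smaller (s≤s (m∸n≤m L j))) right-segment right-residues

      e≋r+j : e ≋ r + j
      e≋r+j = ≋-cancelˡ V (begin
        (V + e) % k            ≡⟨ cong (λ v → (v + e) % k) f-at-minimum ⟨
        (f (P + j) + e) % k    ≡⟨ residues j<1+L ⟩
        (r + (V + j)) % k      ≡⟨ cong (_% k) (x∙yz≈y∙xz r V j) ⟩
        (V + (r + j)) % k      ∎)
        where open ≡-Reasoning

      k∣j⇒e≋r : k ∣ j → e ≋ r
      k∣j⇒e≋r k∣j = trans e≋r+j (trans (≋-+ {r} refl (∣⇒≋0 k∣j)) (cong (_% k) (+-identityʳ r)))

      e≋r⇒j≡0 : e ≋ r → j ≡ 0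
      e≋r⇒j≡0 e≋r = proj₂ (proj₂ left)
        (λ 1+e≋r → shift-≉ 1 z<s (<-trans (n<1+n 1) k≥3) (trans 1+e≋r (sym e≋r)))
        (λ 2+e≋r → shift-≉ 2 z<s k≥3 (trans 2+e≋r (sym e≋r)))

      identity : e ≋ r → ∀ {i} → i < suc L → f (P + i) ≡ V + i
      identity e≋r {i} i<1+L with <-cmp i j
      ... | tri< i<j _ _ = ⊥-elim (n≮0 (subst (i <_) (e≋r⇒j≡0 e≋r) i<j))
      ... | tri≈ _ refl _ = trans f-at-minimum (sym (trans (cong (V +_) (e≋r⇒j≡0 e≋r)) (+-identityʳ V)))
      ... | tri> _ _ j<i with right-position j<i i<1+L
      ...   | y , y<rest , refl = begin
        f (P + (suc j + y))     ≡⟨ cong f (+-assoc P (suc j) y) ⟨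
        f (P + suc j + y)       ≡⟨ proj₁ right e≋r y<rest ⟩
        V + suc j + y           ≡⟨ +-assoc V (suc j) y ⟩
        V + (suc j + y)         ∎
        where open ≡-Reasoning

      blocks : suc e ≋ r → k ∣ suc L × (k ∣ V → Blocks (λ i → f (P + i)) V V (suc L))
      blocks 1+e≋r = subst (k ∣_) lengths (∣m∣n⇒∣m+n k∣1+j (proj₁ right-blocks)) ,
                     λ k∣V → subst (Blocks (λ i → f (P + i)) V V) lengths
                       (Blocks-cons-block j (λ i → f (P + i)) V V rest (proj₁ left 1+e≋r) f-at-minimum
                          (subst (k ∣_) (+-suc V j) (k∣V+1+j k∣V)) (right-blocks′ k∣V))
        where
        right-blocks = proj₁ (proj₂ right) 1+e≋r
        k∣1+j : k ∣ suc j
        k∣1+j = ≋0⇒∣ (≋-cancelˡ r (begin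
          (r + suc j) % k     ≡⟨ cong (_% k) (+-suc r j) ⟩
          suc (r + j) % k     ≡⟨ ≋-suc e≋r+j ⟨
          suc e % k           ≡⟨ 1+e≋r ⟩
          r % k               ≡⟨ cong (_% k) (+-identityʳ r) ⟨
          (r + 0) % k         ∎))
          where open ≡-Reasoning
        k∣V+1+j : k ∣ V → k ∣ V + suc j
        k∣V+1+j k∣V = ∣m∣n⇒∣m+n k∣V k∣1+j
        right-blocks′ : k ∣ V → Blocks (λ i → f (P + (suc j + i))) (suc (V + j)) (suc (V + j)) rest
        right-blocks′ k∣V = subst (λ v → Blocks (λ i → f (P + (suc j + i))) v v rest) (+-suc V j)
          (Blocks-cong (λ i → cong f (+-assoc P (suc j) i)) rest (proj₂ right-blocks (k∣V+1+j k∣V)))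

      empty : ¬ e ≋ r → ¬ suc e ≋ r → suc L ≡ 0
      empty e≉r 1+e≉r = ⊥-elim (e≉r (k∣j⇒e≋r k∣j))
        where
        k∣j : k ∣ j
        k∣j with suc (suc e) % k ≟ r % k
        ... | yes 2+e≋r = proj₁ (proj₁ (proj₂ left) 2+e≋r)
        ... | no 2+e≉r = subst (k ∣_) (sym (proj₂ (proj₂ left) 1+e≉r 2+e≉r)) (k ∣0)

-- Junk value 0 past the end of the vector.
at : ∀ {N m} → Vec (Fin N) m → ℕ → ℕ
at [] _ = 0
at (x ∷ v) zero = toℕ x
at (x ∷ v) (suc i) = at v i

at-lookup : ∀ {N m} (v : Vec (Fin N) m) (i : Fin m) → at v (toℕ i) ≡ toℕ (lookup v i)
at-lookup (x ∷ v) Fin.zero = refl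
at-lookup (x ∷ v) (Fin.suc i) = at-lookup v i

at-fromℕ< : ∀ {N m} (v : Vec (Fin N) m) {i} (i<m : i < m) → at v i ≡ toℕ (lookup v (fromℕ< i<m))
at-fromℕ< v {i} i<m = trans (cong (at v) (sym (toℕ-fromℕ< i<m))) (at-lookup v (fromℕ< i<m))

at< : ∀ {N m} (v : Vec (Fin N) m) {i} → i < m → at v i < N
at< v i<m = subst (_< _) (sym (at-fromℕ< v i<m)) (toℕ<n _)

module OneLineNotation {n : ℕ} (v : Vec (Fin n) n) where

  IsPerm⇒injective : IsPerm v → InjectiveBelow n (at v)
  IsPerm⇒injective perm {i} {j} i<n j<n e = begin
    i                       ≡⟨ toℕ-fromℕ< i<n ⟨
    toℕ (fromℕ< i<n)        ≡⟨ cong toℕ (perm _ _ (toℕ-injective (trans (sym (at-fromℕ< v i<n)) (trans e (at-fromℕ< v j<n))))) ⟩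
    toℕ (fromℕ< j<n)        ≡⟨ toℕ-fromℕ< j<n ⟩
    j                       ∎
    where open ≡-Reasoning

  injective⇒IsPerm : InjectiveBelow n (at v) → IsPerm v
  injective⇒IsPerm inj i j e = toℕ-injective (inj (toℕ<n i) (toℕ<n j)
    (trans (at-lookup v i) (trans (cong toℕ e) (sym (at-lookup v j)))))

  avoids⇒avoids312Below : Avoids312 v → Avoids312Below n (at v)
  avoids⇒avoids312Below avoids {a} {b} {c} a<b b<c c<n fb<fc fc<fa = avoids
    (fromℕ< a<n , fromℕ< b<n , fromℕ< c<n ,
     subst₂ _<_ (sym (toℕ-fromℕ< a<n)) (sym (toℕ-fromℕ< b<n)) a<b ,
     subst₂ _<_ (sym (toℕ-fromℕ< b<n)) (sym (toℕ-fromℕ< c<n)) b<c ,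
     subst₂ _<_ (at-fromℕ< v b<n) (at-fromℕ< v c<n) fb<fc ,
     subst₂ _<_ (at-fromℕ< v c<n) (at-fromℕ< v a<n) fc<fa)
    where
    b<n = <-trans b<c c<n
    a<n = <-trans a<b b<n

  avoids312Below⇒avoids : Avoids312Below n (at v) → Avoids312 v
  avoids312Below⇒avoids avoids (a , b , c , a<b , b<c , fb<fc , fc<fa) = avoids a<b b<c (toℕ<n c)
    (subst₂ _<_ (sym (at-lookup v b)) (sym (at-lookup v c)) fb<fc)
    (subst₂ _<_ (sym (at-lookup v c)) (sym (at-lookup v a)) fc<fa)

  module _ (k r : ℕ) .{{_ : NonZero k}} where
    open Congruence k

    MPResidues : Set
    MPResidues = ∀ {i} → i < n → at v i + 1 ≋ r + i

    InMP⇒residues : (∀ p → (toℕ (lookup v p) + 1) % k ≡ (r + toℕ p) % k) → MPResidues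
    InMP⇒residues res {i} i<n = subst₂ (λ a b → a + 1 ≋ r + b) (sym (at-fromℕ< v i<n)) (toℕ-fromℕ< i<n) (res (fromℕ< i<n))

    residues⇒InMP : MPResidues → ∀ p → (toℕ (lookup v p) + 1) % k ≡ (r + toℕ p) % k
    residues⇒InMP res p = subst (λ a → a + 1 ≋ r + toℕ p) (at-lookup v p) (res (toℕ<n p))

    valid⇒ : InMP k r v × Avoids312 v → InjectiveBelow n (at v) × MPResidues × Avoids312Below n (at v)
    valid⇒ ((perm , res) , avoids) = IsPerm⇒injective perm , InMP⇒residues res , avoids⇒avoids312Below avoids

    ⇒valid : InjectiveBelow n (at v) → MPResidues → Avoids312Below n (at v) → InMP k r v × Avoids312 v
    ⇒valid inj res avoids = (injective⇒IsPerm inj , residues⇒InMP res) , avoids312Below⇒avoids avoids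

-- Counting vectors of each shape

count-consecutive : ∀ {N} m p → p + m ≡ N → count (λ w → consecutive? (at {N} w) p m) (allVecs N m) ≡ 1
count-consecutive zero p _ = refl
count-consecutive {N} (suc m) p p+1+m≡N = begin
  count (λ w → consecutive? (at w) p (suc m)) (allVecs N (suc m))
    ≡⟨ count-allVecs-prepend {N} {m} (λ w → consecutive? (at w) p (suc m)) (λ w → consecutive? (at w) (suc p) m) p id id ⟩
  occurrences p (allFin N) * count (λ w → consecutive? (at w) (suc p) m) (allVecs N m)
    ≡⟨ cong₂ _*_ (occurrences-allFin (subst (p <_) p+1+m≡N (m<m+n p z<s)))
                 (count-consecutive m (suc p) (trans (sym (+-suc p m)) p+1+m≡N)) ⟩
  1 ∎
  where open ≡-Reasoning

m<n⇒n∸m≡1+[n∸1+m] : ∀ {m n} → m < n → n ∸ m ≡ suc (n ∸ suc m)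
m<n⇒n∸m≡1+[n∸1+m] {zero} {suc n} _ = refl
m<n⇒n∸m≡1+[n∸1+m] {suc m} {suc n} (s≤s m<n) = m<n⇒n∸m≡1+[n∸1+m] m<n

2^-double : ∀ e → 2 ^ e + 2 ^ e ≡ 2 ^ suc e
2^-double e = cong (2 ^ e +_) (sym (+-identityʳ (2 ^ e)))

module BlockCounting (k : ℕ) .{{_ : NonZero k}} where
  open BlockStructure k

  #Blocks : ∀ N → ℕ → ℕ → ℕ → ℕ
  #Blocks N s p m = count (λ w → blocks? (at {N} w) s p m) (allVecs N m)

  #ClosingBlocks : ∀ N → ℕ → ℕ → ℕ
  #ClosingBlocks N p m = count (λ w → k ∣? suc p ×-dec blocks? (at {N} w) (suc p) (suc p) m) (allVecs N m)

  #Blocks-suc : ∀ {N} m s p → s ≤ p → s < N →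
    #Blocks N s p (suc m) ≡ occurrences (suc p) (allFin N) * #Blocks N s (suc p) m + #ClosingBlocks N p m
  #Blocks-suc {N} m s p s≤p s<N = begin
    #Blocks N s p (suc m)
      ≡⟨ count-⊎ extend? close? (λ v → blocks? (at v) s p (suc m)) (by-head , from-head) disjoint (allVecs N (suc m)) ⟩
    count extend? (allVecs N (suc m)) + count close? (allVecs N (suc m))
      ≡⟨ cong₂ _+_ (count-allVecs-prepend {N} {m} extend? (λ w → blocks? (at w) s (suc p) m) (suc p) id id)
                   (count-allVecs-prepend {N} {m} close? (λ w → k ∣? suc p ×-dec blocks? (at w) (suc p) (suc p) m) s id id) ⟩
    occurrences (suc p) (allFin N) * #Blocks N s (suc p) m + occurrences s (allFin N) * #ClosingBlocks N p m
      ≡⟨ cong (λ c → occurrences (suc p) (allFin N) * #Blocks N s (suc p) m + c * #ClosingBlocks N p m) (occurrences-allFin s<N) ⟩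
    occurrences (suc p) (allFin N) * #Blocks N s (suc p) m + 1 * #ClosingBlocks N p m
      ≡⟨ cong (occurrences (suc p) (allFin N) * #Blocks N s (suc p) m +_) (*-identityˡ _) ⟩
    occurrences (suc p) (allFin N) * #Blocks N s (suc p) m + #ClosingBlocks N p m ∎
    where
    open ≡-Reasoning
    Extend Close : Vec (Fin N) (suc m) → Set
    Extend (x ∷ w) = toℕ x ≡ suc p × Blocks (at w) s (suc p) m
    Close (x ∷ w) = toℕ x ≡ s × (k ∣ suc p × Blocks (at w) (suc p) (suc p) m)
    extend? : Decidable Extend
    extend? (x ∷ w) = toℕ x ≟ suc p ×-dec blocks? (at w) s (suc p) m
    close? : Decidable Close
    close? (x ∷ w) = toℕ x ≟ s ×-dec (k ∣? suc p ×-dec blocks? (at w) (suc p) (suc p) m)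
    by-head : ∀ {v} → Blocks (at v) s p (suc m) → Extend v ⊎ Close v
    by-head {x ∷ w} (inj₁ e) = inj₁ e
    by-head {x ∷ w} (inj₂ (k∣ , x≡s , b)) = inj₂ (x≡s , k∣ , b)
    from-head : ∀ {v} → Extend v ⊎ Close v → Blocks (at v) s p (suc m)
    from-head {x ∷ w} (inj₁ e) = inj₁ e
    from-head {x ∷ w} (inj₂ (x≡s , k∣ , b)) = inj₂ (k∣ , x≡s , b)
    disjoint : ∀ v → Extend v → ¬ Close v
    disjoint (x ∷ w) (x≡1+p , _) (x≡s , _) = <⇒≢ (s≤s s≤p) (trans (sym x≡s) x≡1+p)

  /-suc : ∀ p → (¬ k ∣ suc p × suc p / k ≡ p / k) ⊎ (k ∣ suc p × suc p / k ≡ suc (p / k))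
  /-suc p with m≤n⇒m<n∨m≡n (m%n<n p k)
  ... | inj₁ 1+ρ<k = inj₁ (k∤ , quotient)
    where
    decompose : suc p ≡ suc (p % k) + p / k * k
    decompose = cong suc (m≡m%n+[m/n]*n p k)
    k∤ : ¬ k ∣ suc p
    k∤ k∣ = 0≢1+n (begin
      0                                 ≡⟨ n∣m⇒m%n≡0 (suc p) k k∣ ⟨
      suc p % k                         ≡⟨ cong (_% k) decompose ⟩
      (suc (p % k) + p / k * k) % k     ≡⟨ [m+kn]%n≡m%n (suc (p % k)) (p / k) k ⟩
      suc (p % k) % k                   ≡⟨ m<n⇒m%n≡m 1+ρ<k ⟩
      suc (p % k)                       ∎)
      where open ≡-Reasoning
    quotient : suc p / k ≡ p / k
    quotient = begin
      suc p / k                          ≡⟨ /-congˡ decompose ⟩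
      (suc (p % k) + p / k * k) / k      ≡⟨ +-distrib-/-∣ʳ (suc (p % k)) (divides (p / k) refl) ⟩
      suc (p % k) / k + p / k * k / k    ≡⟨ cong₂ _+_ (m<n⇒m/n≡0 1+ρ<k) (m*n/n≡m (p / k) k) ⟩
      p / k                              ∎
      where open ≡-Reasoning
  ... | inj₂ 1+ρ≡k = inj₂ (divides (suc (p / k)) multiple , trans (/-congˡ multiple) (m*n/n≡m (suc (p / k)) k))
    where
    multiple : suc p ≡ suc (p / k) * k
    multiple = trans (cong suc (m≡m%n+[m/n]*n p k)) (cong (_+ p / k * k) 1+ρ≡k)

  ∣-/-mono-< : ∀ {a b} → k ∣ a → k ∣ b → a < b → a / k < b / k
  ∣-/-mono-< (divides-refl qa) (divides-refl qb) qa*k<qb*k =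
    subst₂ _<_ (sym (m*n/n≡m qa k)) (sym (m*n/n≡m qb k)) (*-cancelʳ-< k qa qb qa*k<qb*k)

  #ClosingBlocks-∤ : ∀ {N} p m → ¬ k ∣ suc p → #ClosingBlocks N p m ≡ 0
  #ClosingBlocks-∤ {N} p m k∤1+p =
    count-none (λ w → k ∣? suc p ×-dec blocks? (at {N} w) (suc p) (suc p) m)
               (λ _ closing → k∤1+p (proj₁ closing)) (allVecs N m)

  #ClosingBlocks-∣ : ∀ {N} p m → k ∣ suc p → #ClosingBlocks N p m ≡ #Blocks N (suc p) (suc p) m
  #ClosingBlocks-∣ {N} p m k∣1+p = count-≐ (λ w → k ∣? suc p ×-dec blocks? (at {N} w) (suc p) (suc p) m)
    (λ w → blocks? (at {N} w) (suc p) (suc p) m) (proj₂ , (k∣1+p ,_)) (allVecs N m)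

  count-last-block : ∀ {N} s p → k ∣ N → suc p ≡ N → s ≤ p → #Blocks N s p 1 ≡ 2 ^ (N / k ∸ suc (p / k))
  count-last-block {N} s p k∣N 1+p≡N s≤p = begin
    #Blocks N s p 1
      ≡⟨ #Blocks-suc 0 s p s≤p (subst (s <_) 1+p≡N (s≤s s≤p)) ⟩
    occurrences (suc p) (allFin N) * #Blocks N s (suc p) 0 + #ClosingBlocks N p 0
      ≡⟨ cong₂ _+_ (trans (cong (occurrences (suc p) (allFin N) *_) unclosed) (*-zeroʳ (occurrences (suc p) (allFin N))))
                   (trans (#ClosingBlocks-∣ p 0 k∣1+p)
                          (cong length (filter-accept (λ w → blocks? (at {N} w) (suc p) (suc p) 0) refl))) ⟩
    1
      ≡⟨ cong (2 ^_) (n∸n≡0 (N / k)) ⟨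
    2 ^ (N / k ∸ N / k)
      ≡⟨ cong (λ q → 2 ^ (N / k ∸ q)) N/k≡1+p/k ⟩
    2 ^ (N / k ∸ suc (p / k)) ∎
    where
    open ≡-Reasoning
    k∣1+p : k ∣ suc p
    k∣1+p = subst (k ∣_) (sym 1+p≡N) k∣N
    unclosed : #Blocks N s (suc p) 0 ≡ 0
    unclosed = count-none (λ w → blocks? (at {N} w) s (suc p) 0) (λ _ s≡1+p → <⇒≢ (s≤s s≤p) s≡1+p) (allVecs N 0)
    N/k≡1+p/k : N / k ≡ suc (p / k)
    N/k≡1+p/k with /-suc p
    ... | inj₁ (k∤ , _) = ⊥-elim (k∤ k∣1+p)
    ... | inj₂ (_ , 1+p/k≡) = trans (/-congˡ (sym 1+p≡N)) 1+p/k≡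

  -- Each multiple of k strictly between p and N may or may not close a block.
  count-blocks : ∀ {N} m s p → k ∣ N → p + suc m ≡ N → s ≤ p → #Blocks N s p (suc m) ≡ 2 ^ (N / k ∸ suc (p / k))
  count-blocks zero s p k∣N p+1≡N s≤p = count-last-block s p k∣N (trans (+-comm 1 p) p+1≡N) s≤p
  count-blocks {N} (suc m) s p k∣N p+2+m≡N s≤p = begin
    #Blocks N s p (suc (suc m))
      ≡⟨ #Blocks-suc (suc m) s p s≤p (≤-<-trans s≤p (<-trans (n<1+n p) 1+p<N)) ⟩
    occurrences (suc p) (allFin N) * #Blocks N s (suc p) (suc m) + #ClosingBlocks N p (suc m)
      ≡⟨ cong (_+ #ClosingBlocks N p (suc m))
           (cong₂ _*_ (occurrences-allFin 1+p<N) (count-blocks m s (suc p) k∣N 1+p+1+m≡N (m≤n⇒m≤1+n s≤p))) ⟩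
    1 * 2 ^ (N / k ∸ suc (suc p / k)) + #ClosingBlocks N p (suc m)
      ≡⟨ cong (_+ #ClosingBlocks N p (suc m)) (*-identityˡ _) ⟩
    2 ^ (N / k ∸ suc (suc p / k)) + #ClosingBlocks N p (suc m)
      ≡⟨ by-divisibility (/-suc p) ⟩
    2 ^ (N / k ∸ suc (p / k)) ∎
    where
    open ≡-Reasoning
    1+p+1+m≡N : suc p + suc m ≡ N
    1+p+1+m≡N = trans (sym (+-suc p (suc m))) p+2+m≡N
    1+p<N : suc p < N
    1+p<N = subst (suc p <_) 1+p+1+m≡N (m<m+n (suc p) z<s)
    by-divisibility : (¬ k ∣ suc p × suc p / k ≡ p / k) ⊎ (k ∣ suc p × suc p / k ≡ suc (p / k)) →
      2 ^ (N / k ∸ suc (suc p / k)) + #ClosingBlocks N p (suc m) ≡ 2 ^ (N / k ∸ suc (p / k))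
    by-divisibility (inj₁ (k∤1+p , 1+p/k≡p/k)) = begin
      2 ^ (N / k ∸ suc (suc p / k)) + #ClosingBlocks N p (suc m)
        ≡⟨ cong (2 ^ (N / k ∸ suc (suc p / k)) +_) (#ClosingBlocks-∤ {N} p (suc m) k∤1+p) ⟩
      2 ^ (N / k ∸ suc (suc p / k)) + 0
        ≡⟨ +-identityʳ _ ⟩
      2 ^ (N / k ∸ suc (suc p / k))
        ≡⟨ cong (λ q → 2 ^ (N / k ∸ suc q)) 1+p/k≡p/k ⟩
      2 ^ (N / k ∸ suc (p / k)) ∎
    by-divisibility (inj₂ (k∣1+p , 1+p/k≡1+p/k)) = begin
      2 ^ (N / k ∸ suc (suc p / k)) + #ClosingBlocks N p (suc m)
        ≡⟨ cong (2 ^ (N / k ∸ suc (suc p / k)) +_)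
             (trans (#ClosingBlocks-∣ {N} p (suc m) k∣1+p) (count-blocks m (suc p) (suc p) k∣N 1+p+1+m≡N ≤-refl)) ⟩
      2 ^ (N / k ∸ suc (suc p / k)) + 2 ^ (N / k ∸ suc (suc p / k))
        ≡⟨ cong (λ q → 2 ^ (N / k ∸ suc q) + 2 ^ (N / k ∸ suc q)) 1+p/k≡1+p/k ⟩
      2 ^ (N / k ∸ suc (suc (p / k))) + 2 ^ (N / k ∸ suc (suc (p / k)))
        ≡⟨ 2^-double (N / k ∸ suc (suc (p / k))) ⟩
      2 ^ suc (N / k ∸ suc (suc (p / k)))
        ≡⟨ cong (2 ^_) (m<n⇒n∸m≡1+[n∸1+m] (subst (_< N / k) 1+p/k≡1+p/k (∣-/-mono-< k∣1+p k∣N 1+p<N))) ⟨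
      2 ^ (N / k ∸ suc (p / k)) ∎

module ValidPermutation (k : ℕ) .{{_ : NonZero k}} (k≥3 : 3 ≤ k) (r : ℕ) {n : ℕ} (v : Vec (Fin n) n)
                        (valid : InMP k r v × Avoids312 v) where
  open OneLineNotation v
  open Segments n (at v) (proj₁ (valid⇒ k r valid)) (proj₂ (proj₂ (valid⇒ k r valid)))
  open Classification k k≥3 r

  shape : Shape 0 0 n 1
  shape = classify (<-wellFounded n) (record { fits = ≤-refl ; range = λ i<n → z≤n , at< v i<n })
                   (proj₁ (proj₂ (valid⇒ k r valid)))

module Characterisation (k : ℕ) .{{_ : NonZero k}} (k≥3 : 3 ≤ k) {n : ℕ} where
  open Congruence k
  open BlockStructure k
  open OneLineNotation

  consecutive⇒valid : (v : Vec (Fin n) n) → Consecutive (at v) 0 n → InMP k 1 v × Avoids312 v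
  consecutive⇒valid v consecutive = ⇒valid v k 1
    (λ i<n j<n e → trans (sym (at≡ i<n)) (trans e (at≡ j<n)))
    (λ {i} i<n → cong (_% k) (trans (cong (_+ 1) (at≡ i<n)) (+-comm i 1)))
    (λ a<b b<c c<n fb<fc fc<fa → <-asym a<b
       (subst₂ _<_ (at≡ (<-trans b<c c<n)) (at≡ (<-trans a<b (<-trans b<c c<n))) (<-trans fb<fc fc<fa)))
    where
    at≡ : ∀ {i} → i < n → at v i ≡ i
    at≡ = Consecutive⇒≡ (at v) 0 n consecutive

  valid⇔consecutive : (λ v → InMP k 1 v × Avoids312 v) ≐ (λ (v : Vec (Fin n) n) → Consecutive (at v) 0 n)
  valid⇔consecutive = (λ {v} valid → ≡⇒Consecutive (at v) 0 n (proj₁ (ValidPermutation.shape k k≥3 1 v valid) refl))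
                    , (λ {v} → consecutive⇒valid v)

  valid⇔blocks : (λ v → InMP k 2 v × Avoids312 v) ≐ (λ (v : Vec (Fin n) n) → Blocks (at v) 0 0 n)
  valid⇔blocks = (λ {v} valid → proj₂ (proj₁ (proj₂ (ValidPermutation.shape k k≥3 2 v valid)) refl) (k ∣0))
               , (λ {v} blocks → ⇒valid v k 2 (Blocks-injective (at v) blocks z≤n)
                                               (Blocks-residues (at v) blocks (k ∣0))
                                               (Blocks-avoids312 (at v) blocks z≤n))

  no-valid : ∀ r → 1 ≤ n → r ≤ k → r ≢ 1 → ¬ (r ≡ 2 × k ∣ n) → ∀ v → ¬ (InMP k r v × Avoids312 v)
  no-valid r 1≤n r≤k r≢1 ¬[r≡2×k∣n] v valid = by-residue (1 % k ≟ r % k) (2 % k ≟ r % k)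
    where
    open ValidPermutation k k≥3 r v valid using (shape)
    by-residue : Dec (1 ≋ r) → Dec (2 ≋ r) → ⊥
    by-residue (yes 1≋r) _ = r≢1 (sym (≋⇒≡-positive z<s (<-trans (n<1+n 1) k≥3) r≤k 1≋r))
    by-residue (no _) (yes 2≋r) =
      ¬[r≡2×k∣n] (sym (≋⇒≡-positive z<s k≥3 r≤k 2≋r) , proj₁ (proj₁ (proj₂ shape) 2≋r))
    by-residue (no 1≉r) (no 2≉r) = <⇒≢ 1≤n (sym (proj₂ (proj₂ shape) 1≉r 2≉r))

mainTheorem6 : (k n r : ℕ) .{{_ : NonZero k}} → 3 ≤ k → 1 ≤ n → 1 ≤ r → r ≤ k →
    (r ≡ 1 → mp312 n k r ≡ 1) ×
    ((r ≡ 2 → k ∣ n → mp312 n k r ≡ 2 ^ (n / k ∸ 1)) ×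
     (r ≢ 1 → ¬ (r ≡ 2 × k ∣ n) → mp312 n k r ≡ 0))
mainTheorem6 k (suc m) r k≥3 1≤n _ r≤k = r≡1 , r≡2 , otherwise
  where
  open BlockStructure k
  open BlockCounting k
  open Characterisation k k≥3
  n = suc m
  valid? : ∀ r → Decidable (λ (v : Vec (Fin n) n) → InMP k r v × Avoids312 v)
  valid? r v = inMP? k r v ×-dec ¬? (contains312? v)

  r≡1 : r ≡ 1 → mp312 n k r ≡ 1
  r≡1 refl = trans (count-≐ (valid? 1) (λ v → consecutive? (at v) 0 n) valid⇔consecutive (allVecs n n))
                   (count-consecutive n 0 refl)

  r≡2 : r ≡ 2 → k ∣ n → mp312 n k r ≡ 2 ^ (n / k ∸ 1)
  r≡2 refl k∣n = begin
    mp312 n k 2                  ≡⟨ count-≐ (valid? 2) (λ v → blocks? (at v) 0 0 n) valid⇔blocks (allVecs n n) ⟩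
    #Blocks n 0 0 n              ≡⟨ count-blocks m 0 0 k∣n refl z≤n ⟩
    2 ^ (n / k ∸ suc (0 / k))    ≡⟨ cong (λ q → 2 ^ (n / k ∸ suc q)) (0/n≡0 k) ⟩
    2 ^ (n / k ∸ 1)              ∎
    where open ≡-Reasoning

  otherwise : r ≢ 1 → ¬ (r ≡ 2 × k ∣ n) → mp312 n k r ≡ 0
  otherwise r≢1 ¬[r≡2×k∣n] = count-none (valid? r) (no-valid r 1≤n r≤k r≢1 ¬[r≡2×k∣n]) (allVecs n n)
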